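{- Let $Py2$ be the graph with vertex set $A\cup B$, where $A=\{A_0,A_1,A_2,A_3,A_4,A_1',A_2',A_3',A_4'\}$ and $B=\{B_0,B_1,B_2,B_3,B_4,B_5\}$, and edges: $B_5A_i$ for $i=1,\dots,4$; $B_iA_i$ and $B_iA_i'$ for $i=1,\dots,4$; $A_0B$ for every $B\in B$; and $B_0A$ for every $A\in A$. Then $Py2$ is bipartite, hole-free (it has no induced cycle with at least $5$ vertices), and is not a Stick graph.
   Context: A Stick graph is the intersection graph of a set of vertical segments and a set of horizontal segments in the plane whose bottom endpoints (for vertical ones) and left endpoints (for horizontal ones) lie on a fixed line of slope $-1$.
   Formalization: The positions of the segments' endpoints on the line of slope −1 and the segment lengths in a Stick representation of Py2 take values in ℚ. -}

module Defs where

open import Data.Bool using (Bool; true; false; T)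
open import Data.Nat using (ℕ; suc; _+_)
open import Data.Nat.DivMod using (_%_)
open import Data.Fin using (Fin; toℕ)
open import Data.Sum using (_⊎_; inj₁; inj₂)
open import Data.Product using (Σ; ∃; _×_; _,_)
open import Data.Empty using (⊥)
open import Data.Rational using (ℚ; _≤_; _<_; _-_; 0ℚ)
open import Relation.Nullary using (¬_)
open import Relation.Binary.PropositionalEquality using (_≡_; _≢_)
open import Function.Definitions using (Injective)

-- Generic graph notions: a graph is a vertex type V with an adjacency
-- relation E (assumed symmetric and irreflexive for the graphs used).

_⇔′_ : Set → Set → Set
P ⇔′ Q = (P → Q) × (Q → P)

Bipartite : (V : Set) → (V → V → Set) → Set
Bipartite V E = Σ (V → Bool) λ c → ∀ u v → E u v → c u ≢ c v

CycAdj : (m : ℕ) → Fin (5 + m) → Fin (5 + m) → Set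
CycAdj m i j = (toℕ j ≡ (suc (toℕ i)) % (5 + m)) ⊎ (toℕ i ≡ (suc (toℕ j)) % (5 + m))

Hole : (V : Set) → (V → V → Set) → Set
Hole V E = Σ ℕ λ m → Σ (Fin (5 + m) → V) λ f →
  Injective _≡_ _≡_ f × (∀ i j → E (f i) (f j) ⇔′ CycAdj m i j)

HoleFree : (V : Set) → (V → V → Set) → Set
HoleFree V E = ¬ Hole V E

-- The fixed ground line is y = -x; the segment
-- of a vertex v has its ground endpoint at (x v , - x v) and length ℓ v > 0.
-- A vertical segment at p with length l is {p} × [-p , -p + l];
-- a horizontal one at q with length m is [q , q + m] × {-q}.
-- Vertical(p,l) meets horizontal(q,m) iff q ≤ p, p - q ≤ l and p - q ≤ m
-- (intersection point (p , -q)).  Two parallel segments meet iff they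
-- share the ground point (they lie on the same line through distinct
-- ground points otherwise, hence disjoint).

VH-meet : (p l q m : ℚ) → Set
VH-meet p l q m = (q ≤ p) × ((p - q) ≤ l) × ((p - q) ≤ m)

-- vert = true : vertical segment; vert = false : horizontal segment
Meets : Bool → ℚ → ℚ → Bool → ℚ → ℚ → Set
Meets true  p l true  q m = p ≡ q
Meets false p l false q m = p ≡ q
Meets true  p l false q m = VH-meet p l q m
Meets false p l true  q m = VH-meet q m p l

record StickRep (V : Set) (E : V → V → Set) : Set where
  field
    vert    : V → Bool
    x       : V → ℚ
    ℓ       : V → ℚ
    ℓ-pos   : ∀ v → 0ℚ < ℓ v
    correct : ∀ u v → u ≢ v →
              E u v ⇔′ Meets (vert u) (x u) (ℓ u) (vert v) (x v) (ℓ v)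

-- A graph is a Stick graph if it is (isomorphic to) the intersection graph
-- of such a family; we represent directly on its own vertex set.
IsStick : (V : Set) → (V → V → Set) → Set
IsStick V E = StickRep V E

data AV : Set where
  A0 A1 A2 A3 A4 A1' A2' A3' A4' : AV

data BV : Set where
  B0 B1 B2 B3 B4 B5 : BV

adjAB : AV → BV → Bool
adjAB A0  _  = true
adjAB _   B0 = true
adjAB A1  B5 = true
adjAB A2  B5 = true
adjAB A3  B5 = true
adjAB A4  B5 = true
adjAB A1  B1 = true
adjAB A1' B1 = true
adjAB A2  B2 = true
adjAB A2' B2 = true
adjAB A3  B3 = true
adjAB A3' B3 = true
adjAB A4  B4 = true
adjAB A4' B4 = true
adjAB _   _  = false

Py2V : Set
Py2V = AV ⊎ BV

Py2E : Py2V → Py2V → Set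
Py2E (inj₁ a) (inj₂ b) = T (adjAB a b)
Py2E (inj₂ b) (inj₁ a) = T (adjAB a b)
Py2E (inj₁ _) (inj₁ _) = ⊥
Py2E (inj₂ _) (inj₂ _) = ⊥

-- Py2 is bipartite with sides A and B, and A0, B0 are adjacent to the whole
-- opposite side. Every vertex of a hole is an end of an induced path on four
-- vertices along the hole, whose other end lies on the opposite side; so A0 and
-- B0 avoid every hole. What remains, Py2 ∖ {A0, B0}, is the spider with centre
-- B5 and legs A l — B l — A′ l. A vertex of a hole has two neighbours on it, so
-- the vertices A′ l, then B l, then A l and finally B5 are excluded in turn.
--
-- In a Stick representation two parallel adjacent sticks share their ground
-- point, so the longer one would meet every other neighbour of the shorter one
-- and close a triangle; hence all A-sticks are parallel and all B-sticks
-- perpendicular to them. Ordering the ground points along the line, reversed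
-- when the A-sticks are horizontal, an edge a b has b ≤ a, and b₁ ≤ b₂ ≤ a₁ ≤ a₂
-- with edges a₁ b₁, a₂ b₂ forces the edge a₁ b₂. Whichever of B0, B5 comes
-- first, these two rules sort the four legs into three classes that can each
-- hold only one leg.

module Submission where

open import Defs
open import Data.Bool using (Bool; true; false; T; not)
open import Data.Bool.Properties using (¬-not)
open import Data.Empty using (⊥; ⊥-elim)
open import Data.Fin using (Fin; zero; toℕ)
open import Data.Fin.Patterns using (0F; 1F; 2F; 3F)
open import Data.Fin.Properties using (toℕ-injective; toℕ-fromℕ<; toℕ<n; pigeonhole; <⇒≢)
open import Data.Nat using (ℕ; suc; _+_; _*_; _<_; z≤n; s≤s; NonZero; >-nonZero)
open import Data.Nat.DivMod
  using (_%_; _/_; _mod_; m<n⇒m%n≡m; %-distribˡ-+; m%n%n≡m%n; [m+n]%n≡m%n; m%n<n; m≡m%n+[m/n]*n)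
open import Data.Nat.Divisibility using (_∣_; divides; ∣⇒≤)
import Data.Nat.Properties as ℕ
open import Data.Product using (_×_; ∃; ∃₂; _,_; proj₁; proj₂)
import Data.Rational as ℚ
import Data.Rational.Properties as ℚₚ
open import Data.Sum using (_⊎_; inj₁; inj₂)
open import Data.Unit using (tt)
open import Function using (_∘_)
open import Function.Definitions using (Injective)
open import Level using (_⊔_)
open import Relation.Binary.Bundles using (TotalPreorder)
import Relation.Binary.Construct.Flip.EqAndOrd as Flip
open import Relation.Binary.PropositionalEquality
  using (_≡_; _≢_; refl; sym; trans; cong; subst; subst₂; module ≡-Reasoning)
open import Relation.Nullary using (¬_)

≢-≢⇒≡ : ∀ {x y z : Bool} → x ≢ z → y ≢ z → x ≡ y
≢-≢⇒≡ x≢z y≢z = trans (¬-not x≢z) (sym (¬-not y≢z))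

Pairless : ∀ {p} {X : Set} → (X → Set p) → Set p
Pairless P = ∀ {l m} → l ≢ m → P l → P m → ⊥

index₃ : ∀ {p} {P Q R : Set p} → P ⊎ Q ⊎ R → Fin 3
index₃ (inj₁ _)        = 0F
index₃ (inj₂ (inj₁ _)) = 1F
index₃ (inj₂ (inj₂ _)) = 2F

pigeonhole₃ : ∀ {p n} {P Q R : Fin n → Set p} → 3 < n → (∀ l → P l ⊎ Q l ⊎ R l) →
              Pairless P → Pairless Q → Pairless R → ⊥
pigeonhole₃ {P = P} {Q} {R} 3<n classify P-pairless Q-pairless R-pairless
  with pigeonhole 3<n (index₃ ∘ classify)
... | i , j , i<j , same-index = same-class (<⇒≢ i<j) (classify i) (classify j) same-index
  where
  same-class : ∀ {l m} → l ≢ m → (x : P l ⊎ Q l ⊎ R l) (y : P m ⊎ Q m ⊎ R m) → index₃ x ≡ index₃ y → ⊥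
  same-class l≢m (inj₁ p)        (inj₁ p′)        _ = P-pairless l≢m p p′
  same-class l≢m (inj₂ (inj₁ q)) (inj₂ (inj₁ q′)) _ = Q-pairless l≢m q q′
  same-class l≢m (inj₂ (inj₂ r)) (inj₂ (inj₂ r′)) _ = R-pairless l≢m r r′
  same-class _ (inj₁ _)        (inj₂ (inj₁ _)) ()
  same-class _ (inj₁ _)        (inj₂ (inj₂ _)) ()
  same-class _ (inj₂ (inj₁ _)) (inj₁ _)        ()
  same-class _ (inj₂ (inj₁ _)) (inj₂ (inj₂ _)) ()
  same-class _ (inj₂ (inj₂ _)) (inj₁ _)        ()
  same-class _ (inj₂ (inj₂ _)) (inj₂ (inj₁ _)) ()

-- Cyclic indices and holes
module CyclicShift (n : ℕ) .{{_ : NonZero n}} where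
  open ≡-Reasoning

  shift : ℕ → Fin n → Fin n
  shift k i = (toℕ i + k) mod n

  toℕ-shift : ∀ k i → toℕ (shift k i) ≡ (toℕ i + k) % n
  toℕ-shift k i = toℕ-fromℕ< (m%n<n (toℕ i + k) n)

  [m%n+k]%n≡[m+k]%n : ∀ x k → (x % n + k) % n ≡ (x + k) % n
  [m%n+k]%n≡[m+k]%n x k = begin
    (x % n + k) % n          ≡⟨ %-distribˡ-+ (x % n) k n ⟩
    (x % n % n + k % n) % n  ≡⟨ cong (λ y → (y + k % n) % n) (m%n%n≡m%n x n) ⟩
    (x % n + k % n) % n      ≡⟨ %-distribˡ-+ x k n ⟨
    (x + k) % n              ∎

  shift-zero : ∀ i → shift 0 i ≡ i
  shift-zero i = toℕ-injective (begin
    toℕ (shift 0 i)  ≡⟨ toℕ-shift 0 i ⟩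
    (toℕ i + 0) % n  ≡⟨ cong (_% n) (ℕ.+-identityʳ (toℕ i)) ⟩
    toℕ i % n        ≡⟨ m<n⇒m%n≡m (toℕ<n i) ⟩
    toℕ i            ∎)

  shift-n : ∀ i → shift n i ≡ i
  shift-n i = toℕ-injective (begin
    toℕ (shift n i)  ≡⟨ toℕ-shift n i ⟩
    (toℕ i + n) % n  ≡⟨ [m+n]%n≡m%n (toℕ i) n ⟩
    toℕ i % n        ≡⟨ m<n⇒m%n≡m (toℕ<n i) ⟩
    toℕ i            ∎)

  shift-suc : ∀ k i → toℕ (shift (suc k) i) ≡ suc (toℕ (shift k i)) % n
  shift-suc k i = begin
    toℕ (shift (suc k) i)        ≡⟨ toℕ-shift (suc k) i ⟩
    (toℕ i + suc k) % n          ≡⟨ cong (_% n) (ℕ.+-suc (toℕ i) k) ⟩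
    suc (toℕ i + k) % n          ≡⟨ cong (_% n) (ℕ.+-comm 1 (toℕ i + k)) ⟩
    (toℕ i + k + 1) % n          ≡⟨ [m%n+k]%n≡[m+k]%n (toℕ i + k) 1 ⟨
    ((toℕ i + k) % n + 1) % n    ≡⟨ cong (λ y → (y + 1) % n) (toℕ-shift k i) ⟨
    (toℕ (shift k i) + 1) % n    ≡⟨ cong (_% n) (ℕ.+-comm (toℕ (shift k i)) 1) ⟩
    suc (toℕ (shift k i)) % n    ∎

  shift-shift : ∀ a b i → shift a (shift b i) ≡ shift (b + a) i
  shift-shift a b i = toℕ-injective (begin
    toℕ (shift a (shift b i))    ≡⟨ toℕ-shift a (shift b i) ⟩
    (toℕ (shift b i) + a) % n    ≡⟨ cong (λ y → (y + a) % n) (toℕ-shift b i) ⟩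
    ((toℕ i + b) % n + a) % n    ≡⟨ [m%n+k]%n≡[m+k]%n (toℕ i + b) a ⟩
    (toℕ i + b + a) % n          ≡⟨ cong (_% n) (ℕ.+-assoc (toℕ i) b a) ⟩
    (toℕ i + (b + a)) % n        ≡⟨ toℕ-shift (b + a) i ⟨
    toℕ (shift (b + a) i)        ∎)

  -- (t + k) % n ≡ t forces n ∣ k.
  shift-≢ : ∀ {k} → 0 < k → k < n → ∀ i → shift k i ≢ i
  shift-≢ {k} 0<k k<n i shift≡i = ℕ.<⇒≱ k<n (∣⇒≤ {{>-nonZero 0<k}} n∣k)
    where
    t = toℕ i
    [t+k]%n≡t : (t + k) % n ≡ t
    [t+k]%n≡t = trans (sym (toℕ-shift k i)) (cong toℕ shift≡i)
    n∣k : n ∣ k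
    n∣k = divides ((t + k) / n) (ℕ.+-cancelˡ-≡ t k _ (begin
      t + k                          ≡⟨ m≡m%n+[m/n]*n (t + k) n ⟩
      (t + k) % n + (t + k) / n * n  ≡⟨ cong (_+ (t + k) / n * n) [t+k]%n≡t ⟩
      t + (t + k) / n * n            ∎))

module HoleFacts {V : Set} {E : V → V → Set} (m : ℕ) (f : Fin (5 + m) → V)
                 (f-injective : Injective _≡_ _≡_ f)
                 (f-adj : ∀ i j → E (f i) (f j) ⇔′ CycAdj m i j) where
  open CyclicShift (5 + m)

  hole-step : ∀ k i → E (f (shift k i)) (f (shift (suc k) i))
  hole-step k i = proj₂ (f-adj _ _) (inj₁ (shift-suc k i))

  hole-step-back : ∀ k i → E (f (shift (suc k) i)) (f (shift k i))
  hole-step-back k i = proj₂ (f-adj _ _) (inj₂ (shift-suc k i))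

  hole-step₀ : ∀ i → E (f i) (f (shift 1 i))
  hole-step₀ i = subst (λ j → E (f j) (f (shift 1 i))) (shift-zero i) (hole-step 0 i)

  hole-gap : ∀ i → ¬ E (f i) (f (shift 3 i))
  hole-gap i e with proj₁ (f-adj i (shift 3 i)) e
  ... | inj₁ 3-follows-0 =
    shift-≢ (s≤s z≤n) (s≤s (s≤s (s≤s z≤n))) (shift 1 i)
      (trans (shift-shift 2 1 i) (toℕ-injective (trans 3-follows-0 (sym 1-follows-0))))
    where
    1-follows-0 : toℕ (shift 1 i) ≡ suc (toℕ i) % (5 + m)
    1-follows-0 = trans (shift-suc 0 i) (cong (λ j → suc (toℕ j) % (5 + m)) (shift-zero i))
  ... | inj₂ 0-follows-3 =
    shift-≢ (s≤s z≤n) (s≤s (s≤s (s≤s (s≤s (s≤s z≤n))))) i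
      (sym (toℕ-injective (trans 0-follows-3 (sym (shift-suc 3 i)))))

  hole-neighbours : ∀ i → ∃₂ λ j k → j ≢ k × E (f i) (f j) × E (f i) (f k)
  hole-neighbours i = shift 1 i , shift (4 + m) i , 1≢4+m , hole-step₀ i ,
                      subst (λ j → E (f j) (f (shift (4 + m) i))) (shift-n i) (hole-step-back (4 + m) i)
    where
    1≢4+m : shift 1 i ≢ shift (4 + m) i
    1≢4+m eq = shift-≢ (s≤s z≤n) (s≤s (s≤s (s≤s (s≤s (ℕ.n≤1+n m))))) (shift 1 i)
                 (trans (shift-shift (3 + m) 1 i) (sym eq))

  dominating-off-hole : (c : V → Bool) → (∀ u v → E u v → c u ≢ c v) →
                        ∀ {u} → (∀ {w} → c w ≢ c u → E u w) → ∀ i → f i ≢ u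
  dominating-off-hole c c-proper dominates i refl = hole-gap i (dominates c₃≢c₀)
    where
    c₀≡c₂ : c (f i) ≡ c (f (shift 2 i))
    c₀≡c₂ = ≢-≢⇒≡ (c-proper _ _ (hole-step₀ i))
                   (λ eq → c-proper _ _ (hole-step 1 i) (sym eq))
    c₃≢c₀ : c (f (shift 3 i)) ≢ c (f i)
    c₃≢c₀ eq = c-proper _ _ (hole-step 2 i) (trans (sym c₀≡c₂) (sym eq))

  unique-neighbour-off-hole : ∀ {u} → (∀ i j → E u (f i) → E u (f j) → f i ≡ f j) → ∀ i → f i ≢ u
  unique-neighbour-off-hole unique i refl with hole-neighbours i
  ... | j , k , j≢k , e-j , e-k = j≢k (f-injective (unique j k e-j e-k))

bipartite⇒triangle-free : ∀ {V : Set} {E : V → V → Set} → Bipartite V E →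
                          ∀ {u v w} → E u v → E u w → ¬ E v w
bipartite⇒triangle-free (c , c-proper) {u} {v} {w} e-uv e-uw e-vw =
  c-proper v w e-vw (≢-≢⇒≡ (c-proper u v e-uv ∘ sym) (c-proper u w e-uw ∘ sym))

-- Stick geometry
VH-meet-exchange : ∀ {p₁ l₁ q₁ m₁ p₂ l₂ q₂ m₂} → q₁ ℚ.≤ q₂ → q₂ ℚ.≤ p₁ → p₁ ℚ.≤ p₂ →
                   VH-meet p₁ l₁ q₁ m₁ → VH-meet p₂ l₂ q₂ m₂ → VH-meet p₁ l₁ q₂ m₂
VH-meet-exchange {p₁} {q₂ = q₂} q₁≤q₂ q₂≤p₁ p₁≤p₂ (_ , p₁-q₁≤l₁ , _) (_ , _ , p₂-q₂≤m₂) =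
  q₂≤p₁ ,
  ℚₚ.≤-trans (ℚₚ.+-monoʳ-≤ p₁ (ℚₚ.neg-antimono-≤ q₁≤q₂)) p₁-q₁≤l₁ ,
  ℚₚ.≤-trans (ℚₚ.+-monoˡ-≤ (ℚ.- q₂) p₁≤p₂) p₂-q₂≤m₂

HV-meets : ∀ {s t p l q m} → s ≡ false → t ≡ true → Meets s p l t q m ⇔′ VH-meet q m p l
HV-meets refl refl = (λ meet → meet) , (λ meet → meet)

longer-meets-more : ∀ s t {p l l′ q m} → l ℚ.≤ l′ → Meets s p l t q m → Meets s p l′ t q m
longer-meets-more true  true  _    meet              = meet
longer-meets-more true  false l≤l′ (q≤p , d≤l , d≤m) = q≤p , ℚₚ.≤-trans d≤l l≤l′ , d≤m
longer-meets-more false true  l≤l′ (p≤q , d≤m , d≤l) = p≤q , d≤m , ℚₚ.≤-trans d≤l l≤l′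
longer-meets-more false false _    meet              = meet

parallel-meet⇒same-ground : ∀ s {p l q m} → Meets s p l s q m → p ≡ q
parallel-meet⇒same-ground true  p≡q = p≡q
parallel-meet⇒same-ground false p≡q = p≡q

module StickGeometry {V : Set} {E : V → V → Set} (S : StickRep V E) where
  open StickRep S

  crossing-meets : ∀ {h v} → vert h ≡ false → vert v ≡ true → E h v ⇔′ VH-meet (x v) (ℓ v) (x h) (ℓ h)
  crossing-meets {h} {v} h-horizontal v-vertical =
    (λ e → proj₁ (HV-meets h-horizontal v-vertical) (proj₁ (correct h v h≢v) e)) ,
    (λ meet → proj₂ (correct h v h≢v) (proj₂ (HV-meets h-horizontal v-vertical) meet))
    where
    h≢v : h ≢ v
    h≢v h≡v with trans (sym h-horizontal) (trans (cong vert h≡v) v-vertical)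
    ... | ()

  crossing-ordered : ∀ {h v} → vert h ≡ false → vert v ≡ true → E h v → x h ℚ.≤ x v
  crossing-ordered h-horizontal v-vertical e = proj₁ (proj₁ (crossing-meets h-horizontal v-vertical) e)

  crossing-exchange : ∀ {h₁ h₂ v₁ v₂} → vert h₁ ≡ false → vert h₂ ≡ false →
                      vert v₁ ≡ true → vert v₂ ≡ true → E h₁ v₁ → E h₂ v₂ →
                      x h₁ ℚ.≤ x h₂ → x h₂ ℚ.≤ x v₁ → x v₁ ℚ.≤ x v₂ → E h₂ v₁
  crossing-exchange h₁-hor h₂-hor v₁-ver v₂-ver e₁ e₂ h₁≤h₂ h₂≤v₁ v₁≤v₂ =
    proj₂ (crossing-meets h₂-hor v₁-ver)
      (VH-meet-exchange h₁≤h₂ h₂≤v₁ v₁≤v₂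
        (proj₁ (crossing-meets h₁-hor v₁-ver) e₁) (proj₁ (crossing-meets h₂-hor v₂-ver) e₂))

  module _ (E-sym : ∀ {u v} → E u v → E v u)
           (triangle-free : ∀ {u v w} → E u v → E u w → ¬ E v w)
           (two-neighbours : ∀ u → ∃₂ λ w₁ w₂ → w₁ ≢ w₂ × E u w₁ × E u w₂) where

    adjacent⇒≢ : ∀ {u v} → E u v → u ≢ v
    adjacent⇒≢ e refl = triangle-free e e e

    longer-inherits : ∀ {u v w} → vert u ≡ vert v → ℓ u ℚ.≤ ℓ v → E u v → E u w → v ≢ w → E v w
    longer-inherits {u} {v} {w} same ℓu≤ℓv e-uv e-uw v≢w = proj₂ (correct v w v≢w)
      (longer-meets-more (vert v) (vert w) ℓu≤ℓv
        (subst₂ (λ s p → Meets s p (ℓ u) (vert w) (x w) (ℓ w)) same same-ground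
          (proj₁ (correct u w (adjacent⇒≢ e-uw)) e-uw)))
      where
      same-ground : x u ≡ x v
      same-ground = parallel-meet⇒same-ground (vert v)
        (subst (λ s → Meets s (x u) (ℓ u) (vert v) (x v) (ℓ v)) same
          (proj₁ (correct u v (adjacent⇒≢ e-uv)) e-uv))

    -- A second neighbour w of u would be a neighbour of v too, closing a triangle.
    shorter-parallel-⊥ : ∀ {u v} → vert u ≡ vert v → ℓ u ℚ.≤ ℓ v → E u v → ⊥
    shorter-parallel-⊥ {u} {v} same ℓu≤ℓv e-uv with two-neighbours u
    ... | w₁ , w₂ , w₁≢w₂ , e-uw₁ , e-uw₂ =
      triangle-with e-uw₁ λ v≡w₁ → triangle-with e-uw₂ λ v≡w₂ → w₁≢w₂ (trans (sym v≡w₁) v≡w₂)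
      where
      triangle-with : ∀ {w} → E u w → ¬ v ≢ w
      triangle-with e-uw v≢w = triangle-free e-uv e-uw (longer-inherits same ℓu≤ℓv e-uv e-uw v≢w)

    adjacent-perpendicular : ∀ {u v} → E u v → vert u ≢ vert v
    adjacent-perpendicular {u} {v} e same with ℚₚ.≤-total (ℓ u) (ℓ v)
    ... | inj₁ ℓu≤ℓv = shorter-parallel-⊥ same ℓu≤ℓv e
    ... | inj₂ ℓv≤ℓu = shorter-parallel-⊥ (sym same) ℓv≤ℓu (E-sym e)

record StickOrdering {c ℓ₁ ℓ₂} (O : TotalPreorder c ℓ₁ ℓ₂) {X Y : Set} (Adj : X → Y → Set)
                     : Set (c ⊔ ℓ₂) where
  open TotalPreorder O using (Carrier; _≲_)
  field
    pos₁ : X → Carrier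
    pos₂ : Y → Carrier
    edge-ordered : ∀ {x y} → Adj x y → pos₂ y ≲ pos₁ x
    exchange : ∀ {x₁ x₂ y₁ y₂} → Adj x₁ y₁ → Adj x₂ y₂ →
               pos₂ y₁ ≲ pos₂ y₂ → pos₂ y₂ ≲ pos₁ x₁ → pos₁ x₁ ≲ pos₁ x₂ → Adj x₁ y₂

-- The graph Py2
Adj : AV → BV → Set
Adj a b = T (adjAB a b)

-- The four legs B5 — A l — B l — A′ l of the tree Py2 ∖ {A0, B0}.
Leg : Set
Leg = Fin 4

A A′ : Leg → AV
A 0F = A1
A 1F = A2
A 2F = A3
A 3F = A4
A′ 0F = A1'
A′ 1F = A2'
A′ 2F = A3'
A′ 3F = A4'

B : Leg → BV
B 0F = B1
B 1F = B2
B 2F = B3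
B 3F = B4

data AView : AV → Set where
  A0-view : AView A0
  A-view  : ∀ l → AView (A l)
  A′-view : ∀ l → AView (A′ l)

aview : ∀ a → AView a
aview A0  = A0-view
aview A1  = A-view 0F
aview A2  = A-view 1F
aview A3  = A-view 2F
aview A4  = A-view 3F
aview A1' = A′-view 0F
aview A2' = A′-view 1F
aview A3' = A′-view 2F
aview A4' = A′-view 3F

data BView : BV → Set where
  B0-view : BView B0
  B5-view : BView B5
  B-view  : ∀ l → BView (B l)

bview : ∀ b → BView b
bview B0 = B0-view
bview B1 = B-view 0F
bview B2 = B-view 1F
bview B3 = B-view 2F
bview B4 = B-view 3F
bview B5 = B5-view

A0-adj : ∀ b → Adj A0 b
A0-adj _ = tt

adj-B0 : ∀ a → Adj a B0
adj-B0 A0  = tt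
adj-B0 A1  = tt
adj-B0 A2  = tt
adj-B0 A3  = tt
adj-B0 A4  = tt
adj-B0 A1' = tt
adj-B0 A2' = tt
adj-B0 A3' = tt
adj-B0 A4' = tt

A-adj-B5 : ∀ l → Adj (A l) B5
A-adj-B5 0F = tt
A-adj-B5 1F = tt
A-adj-B5 2F = tt
A-adj-B5 3F = tt

A-adj-B : ∀ l → Adj (A l) (B l)
A-adj-B 0F = tt
A-adj-B 1F = tt
A-adj-B 2F = tt
A-adj-B 3F = tt

A′-adj-B : ∀ l → Adj (A′ l) (B l)
A′-adj-B 0F = tt
A′-adj-B 1F = tt
A′-adj-B 2F = tt
A′-adj-B 3F = tt

A′-nonadj-B5 : ∀ l → ¬ Adj (A′ l) B5
A′-nonadj-B5 0F ()
A′-nonadj-B5 1F ()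
A′-nonadj-B5 2F ()
A′-nonadj-B5 3F ()

A-adj-B⇒≡ : ∀ {l m} → Adj (A l) (B m) → l ≡ m
A-adj-B⇒≡ {0F} {0F} _ = refl
A-adj-B⇒≡ {0F} {1F} ()
A-adj-B⇒≡ {0F} {2F} ()
A-adj-B⇒≡ {0F} {3F} ()
A-adj-B⇒≡ {1F} {0F} ()
A-adj-B⇒≡ {1F} {1F} _ = refl
A-adj-B⇒≡ {1F} {2F} ()
A-adj-B⇒≡ {1F} {3F} ()
A-adj-B⇒≡ {2F} {0F} ()
A-adj-B⇒≡ {2F} {1F} ()
A-adj-B⇒≡ {2F} {2F} _ = refl
A-adj-B⇒≡ {2F} {3F} ()
A-adj-B⇒≡ {3F} {0F} ()
A-adj-B⇒≡ {3F} {1F} ()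
A-adj-B⇒≡ {3F} {2F} ()
A-adj-B⇒≡ {3F} {3F} _ = refl

A′-adj-B⇒≡ : ∀ {l m} → Adj (A′ l) (B m) → l ≡ m
A′-adj-B⇒≡ {0F} {0F} _ = refl
A′-adj-B⇒≡ {0F} {1F} ()
A′-adj-B⇒≡ {0F} {2F} ()
A′-adj-B⇒≡ {0F} {3F} ()
A′-adj-B⇒≡ {1F} {0F} ()
A′-adj-B⇒≡ {1F} {1F} _ = refl
A′-adj-B⇒≡ {1F} {2F} ()
A′-adj-B⇒≡ {1F} {3F} ()
A′-adj-B⇒≡ {2F} {0F} ()
A′-adj-B⇒≡ {2F} {1F} ()
A′-adj-B⇒≡ {2F} {2F} _ = refl
A′-adj-B⇒≡ {2F} {3F} ()
A′-adj-B⇒≡ {3F} {0F} ()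
A′-adj-B⇒≡ {3F} {1F} ()
A′-adj-B⇒≡ {3F} {2F} ()
A′-adj-B⇒≡ {3F} {3F} _ = refl

side : Py2V → Bool
side (inj₁ _) = true
side (inj₂ _) = false

side-proper : ∀ u v → Py2E u v → side u ≢ side v
side-proper (inj₁ _) (inj₂ _) _ ()
side-proper (inj₂ _) (inj₁ _) _ ()

Py2E-sym : ∀ {u v} → Py2E u v → Py2E v u
Py2E-sym {inj₁ _} {inj₂ _} e = e
Py2E-sym {inj₂ _} {inj₁ _} e = e

py2-bipartite : Bipartite Py2V Py2E
py2-bipartite = side , side-proper

-- Holes in Py2
A0-dominates : ∀ {w} → side w ≢ side (inj₁ A0) → Py2E (inj₁ A0) w
A0-dominates {inj₁ _} different = ⊥-elim (different refl)
A0-dominates {inj₂ b} _         = A0-adj b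

B0-dominates : ∀ {w} → side w ≢ side (inj₂ B0) → Py2E (inj₂ B0) w
B0-dominates {inj₁ a} _         = adj-B0 a
B0-dominates {inj₂ _} different = ⊥-elim (different refl)

A′-neighbour : ∀ {l v} → Py2E (inj₁ (A′ l)) v → v ≢ inj₂ B0 → v ≡ inj₂ (B l)
A′-neighbour {l} {inj₂ b} e v≢B0 with bview b
... | B0-view  = ⊥-elim (v≢B0 refl)
... | B5-view  = ⊥-elim (A′-nonadj-B5 l e)
... | B-view m = cong (inj₂ ∘ B) (sym (A′-adj-B⇒≡ e))

B-neighbour : ∀ {l v} → Py2E (inj₂ (B l)) v → v ≢ inj₁ A0 → v ≢ inj₁ (A′ l) → v ≡ inj₁ (A l)
B-neighbour {l} {inj₁ a} e v≢A0 v≢A′ with aview a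
... | A0-view   = ⊥-elim (v≢A0 refl)
... | A-view m  = cong (inj₁ ∘ A) (A-adj-B⇒≡ e)
... | A′-view m = ⊥-elim (v≢A′ (cong (inj₁ ∘ A′) (A′-adj-B⇒≡ e)))

A-neighbour : ∀ {l v} → Py2E (inj₁ (A l)) v → v ≢ inj₂ B0 → v ≢ inj₂ (B l) → v ≡ inj₂ B5
A-neighbour {l} {inj₂ b} e v≢B0 v≢B with bview b
... | B0-view  = ⊥-elim (v≢B0 refl)
... | B5-view  = refl
... | B-view m = ⊥-elim (v≢B (cong (inj₂ ∘ B) (sym (A-adj-B⇒≡ e))))

B5-neighbour : ∀ {v} → Py2E (inj₂ B5) v → v ≢ inj₁ A0 → ∃ λ l → v ≡ inj₁ (A l)
B5-neighbour {inj₁ a} e v≢A0 with aview a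
... | A0-view   = ⊥-elim (v≢A0 refl)
... | A-view l  = l , refl
... | A′-view l = ⊥-elim (A′-nonadj-B5 l e)

module Py2Hole (m : ℕ) (f : Fin (5 + m) → Py2V) (f-injective : Injective _≡_ _≡_ f)
               (f-adj : ∀ i j → Py2E (f i) (f j) ⇔′ CycAdj m i j) where
  open HoleFacts {E = Py2E} m f f-injective f-adj

  Off : Py2V → Set
  Off v = ∀ i → f i ≢ v

  A0-off : Off (inj₁ A0)
  A0-off = dominating-off-hole side side-proper A0-dominates

  B0-off : Off (inj₂ B0)
  B0-off = dominating-off-hole side side-proper B0-dominates

  A′-off : ∀ l → Off (inj₁ (A′ l))
  A′-off l = unique-neighbour-off-hole λ i j e e′ →
    trans (A′-neighbour e (B0-off i)) (sym (A′-neighbour e′ (B0-off j)))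

  B-off : ∀ l → Off (inj₂ (B l))
  B-off l = unique-neighbour-off-hole λ i j e e′ →
    trans (B-neighbour e (A0-off i) (A′-off l i)) (sym (B-neighbour e′ (A0-off j) (A′-off l j)))

  A-off : ∀ l → Off (inj₁ (A l))
  A-off l = unique-neighbour-off-hole λ i j e e′ →
    trans (A-neighbour e (B0-off i) (B-off l i)) (sym (A-neighbour e′ (B0-off j) (B-off l j)))

  B5-off : Off (inj₂ B5)
  B5-off = unique-neighbour-off-hole λ i _ e _ →
    let (l , fi≡A) = B5-neighbour e (A0-off i) in ⊥-elim (A-off l i fi≡A)

  all-off : ∀ v → Off v
  all-off (inj₁ a) with aview a
  ... | A0-view   = A0-off
  ... | A-view l  = A-off l
  ... | A′-view l = A′-off l
  all-off (inj₂ b) with bview b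
  ... | B0-view  = B0-off
  ... | B5-view  = B5-off
  ... | B-view l = B-off l

py2-hole-free : HoleFree Py2V Py2E
py2-hole-free (m , f , f-injective , f-adj) = Py2Hole.all-off m f f-injective f-adj (f zero) zero refl

-- Stick representations of Py2
py2-two-neighbours : ∀ u → ∃₂ λ w₁ w₂ → w₁ ≢ w₂ × Py2E u w₁ × Py2E u w₂
py2-two-neighbours (inj₁ A0)  = inj₂ B0 , inj₂ B5 , (λ ()) , tt , tt
py2-two-neighbours (inj₁ A1)  = inj₂ B0 , inj₂ B5 , (λ ()) , tt , tt
py2-two-neighbours (inj₁ A2)  = inj₂ B0 , inj₂ B5 , (λ ()) , tt , tt
py2-two-neighbours (inj₁ A3)  = inj₂ B0 , inj₂ B5 , (λ ()) , tt , tt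
py2-two-neighbours (inj₁ A4)  = inj₂ B0 , inj₂ B5 , (λ ()) , tt , tt
py2-two-neighbours (inj₁ A1') = inj₂ B0 , inj₂ B1 , (λ ()) , tt , tt
py2-two-neighbours (inj₁ A2') = inj₂ B0 , inj₂ B2 , (λ ()) , tt , tt
py2-two-neighbours (inj₁ A3') = inj₂ B0 , inj₂ B3 , (λ ()) , tt , tt
py2-two-neighbours (inj₁ A4') = inj₂ B0 , inj₂ B4 , (λ ()) , tt , tt
py2-two-neighbours (inj₂ B0)  = inj₁ A0 , inj₁ A1 , (λ ()) , tt , tt
py2-two-neighbours (inj₂ B1)  = inj₁ A0 , inj₁ A1 , (λ ()) , tt , tt
py2-two-neighbours (inj₂ B2)  = inj₁ A0 , inj₁ A2 , (λ ()) , tt , tt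
py2-two-neighbours (inj₂ B3)  = inj₁ A0 , inj₁ A3 , (λ ()) , tt , tt
py2-two-neighbours (inj₂ B4)  = inj₁ A0 , inj₁ A4 , (λ ()) , tt , tt
py2-two-neighbours (inj₂ B5)  = inj₁ A0 , inj₁ A1 , (λ ()) , tt , tt

module Py2Sticks (S : StickRep Py2V Py2E) where
  open StickRep S
  open StickGeometry S

  perpendicular : ∀ {u v} → Py2E u v → vert u ≢ vert v
  perpendicular = adjacent-perpendicular (λ {u v} → Py2E-sym {u} {v})
    (λ {u v w} → bipartite⇒triangle-free py2-bipartite {u} {v} {w}) py2-two-neighbours

  A-parallel : ∀ a → vert (inj₁ a) ≡ vert (inj₁ A0)
  A-parallel a = ≢-≢⇒≡ (perpendicular {inj₁ a} {inj₂ B0} (adj-B0 a))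
                       (perpendicular {inj₁ A0} {inj₂ B0} tt)

  B-perpendicular : ∀ b → vert (inj₂ b) ≡ not (vert (inj₁ A0))
  B-perpendicular b = ¬-not (perpendicular {inj₂ b} {inj₁ A0} (A0-adj b))

  vertical-A-ordering : vert (inj₁ A0) ≡ true → StickOrdering ℚₚ.≤-totalPreorder Adj
  vertical-A-ordering A0-vertical = record
    { pos₁         = x ∘ inj₁
    ; pos₂         = x ∘ inj₂
    ; edge-ordered = λ {a} {b} → crossing-ordered (B-horizontal b) (A-vertical a)
    ; exchange     = λ {a₁} {a₂} {b₁} {b₂} →
                     crossing-exchange (B-horizontal b₁) (B-horizontal b₂) (A-vertical a₁) (A-vertical a₂)
    }
    where
    A-vertical : ∀ a → vert (inj₁ a) ≡ true
    A-vertical a = trans (A-parallel a) A0-vertical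
    B-horizontal : ∀ b → vert (inj₂ b) ≡ false
    B-horizontal b = trans (B-perpendicular b) (cong not A0-vertical)

  -- With horizontal A-sticks the ground points are read in the reverse order.
  horizontal-A-ordering : vert (inj₁ A0) ≡ false →
                          StickOrdering (Flip.totalPreorder ℚₚ.≤-totalPreorder) Adj
  horizontal-A-ordering A0-horizontal = record
    { pos₁         = x ∘ inj₁
    ; pos₂         = x ∘ inj₂
    ; edge-ordered = λ {a} {b} → crossing-ordered (A-horizontal a) (B-vertical b)
    ; exchange     = λ {a₁} {a₂} {b₁} {b₂} e₁ e₂ b₂≤b₁ a₁≤b₂ a₂≤a₁ →
                     crossing-exchange (A-horizontal a₂) (A-horizontal a₁) (B-vertical b₂) (B-vertical b₁)
                       e₂ e₁ a₂≤a₁ a₁≤b₂ b₂≤b₁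
    }
    where
    A-horizontal : ∀ a → vert (inj₁ a) ≡ false
    A-horizontal a = trans (A-parallel a) A0-horizontal
    B-vertical : ∀ b → vert (inj₂ b) ≡ true
    B-vertical b = trans (B-perpendicular b) (cong not A0-horizontal)

module Py2StickOrdering {c ℓ₁ ℓ₂} {O : TotalPreorder c ℓ₁ ℓ₂} (σ : StickOrdering O Adj) where
  open TotalPreorder O using (Carrier; _≲_; total) renaming (trans to ≲-trans)
  open StickOrdering σ

  ≴⇒≳ : ∀ {p q} → ¬ p ≲ q → q ≲ p
  ≴⇒≳ {p} {q} p≴q with total p q
  ... | inj₁ p≲q = ⊥-elim (p≴q p≲q)
  ... | inj₂ q≲p = q≲p

  no-exchange : ∀ {x₁ x₂ y₁ y₂} → Adj x₁ y₁ → Adj x₂ y₂ → ¬ Adj x₁ y₂ →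
                pos₂ y₁ ≲ pos₂ y₂ → pos₂ y₂ ≲ pos₁ x₁ → ¬ pos₁ x₁ ≲ pos₁ x₂
  no-exchange e₁ e₂ ¬e y₁≲y₂ y₂≲x₁ x₁≲x₂ = ¬e (exchange e₁ e₂ y₁≲y₂ y₂≲x₁ x₁≲x₂)

  a a′ b : Leg → Carrier
  a  l = pos₁ (A l)
  a′ l = pos₁ (A′ l)
  b  l = pos₂ (B l)

  a₀ b₀ b₅ : Carrier
  a₀ = pos₁ A0
  b₀ = pos₂ B0
  b₅ = pos₂ B5

  A-nonadj-B : ∀ {l m} → l ≢ m → ¬ Adj (A l) (B m)
  A-nonadj-B l≢m = l≢m ∘ A-adj-B⇒≡

  A′-nonadj-B : ∀ {l m} → l ≢ m → ¬ Adj (A′ l) (B m)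
  A′-nonadj-B l≢m = l≢m ∘ A′-adj-B⇒≡

  Low High Early Late Beyond : Leg → Set ℓ₂
  Low    l = b l ≲ b₀
  High   l = b₀ ≲ b l
  Early  l = a l ≲ a₀
  Late   l = a₀ ≲ a l
  Beyond l = ∀ m → a m ≲ a′ l

  b≲a₀ : ∀ l → b l ≲ a₀
  b≲a₀ l = edge-ordered (A0-adj (B l))

  b₀≲a : ∀ l → b₀ ≲ a l
  b₀≲a l = edge-ordered (adj-B0 (A l))

  b₀≲a′ : ∀ l → b₀ ≲ a′ l
  b₀≲a′ l = edge-ordered (adj-B0 (A′ l))

  b₅≲a : ∀ l → b₅ ≲ a l
  b₅≲a l = edge-ordered (A-adj-B5 l)

  b≲a : ∀ l → b l ≲ a l
  b≲a l = edge-ordered (A-adj-B l)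

  b≲a′ : ∀ l → b l ≲ a′ l
  b≲a′ l = edge-ordered (A′-adj-B l)

  low-pair-¬early : ∀ {l m} → l ≢ m → b l ≲ b m → Low m → ¬ Early l
  low-pair-¬early {l} {m} l≢m bl≲bm low-m =
    no-exchange (A-adj-B l) (A0-adj (B m)) (A-nonadj-B l≢m) bl≲bm (≲-trans low-m (b₀≲a l))

  low-pair-¬a′≲a : ∀ {l m} → l ≢ m → b l ≲ b m → Low m → ¬ a′ l ≲ a m
  low-pair-¬a′≲a {l} {m} l≢m bl≲bm low-m =
    no-exchange (A′-adj-B l) (A-adj-B m) (A′-nonadj-B l≢m) bl≲bm (≲-trans low-m (b₀≲a′ l))

  low-pair-¬beyond : ∀ {l m} → l ≢ m → b l ≲ b m → Low m → ¬ Beyond m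
  low-pair-¬beyond {l} {m} l≢m bl≲bm low-m beyond-m =
    no-exchange (A-adj-B l) (A′-adj-B m) (A-nonadj-B l≢m) bl≲bm (≲-trans low-m (b₀≲a l)) (beyond-m l)

  module B0-first (b₀≲b₅ : b₀ ≲ b₅) where

    Short : Leg → Set ℓ₂
    Short l = a′ l ≲ b₅

    short-or-beyond : ∀ l → Short l ⊎ Beyond l
    short-or-beyond l with total (a′ l) b₅
    ... | inj₁ short = inj₁ short
    ... | inj₂ b₅≲a′ = inj₂ λ m →
      ≴⇒≳ (no-exchange (adj-B0 (A′ l)) (A-adj-B5 m) (A′-nonadj-B5 l) b₀≲b₅ b₅≲a′)

    short-high-¬a≲a : ∀ {l m} → l ≢ m → Short m → High m → ¬ a l ≲ a m
    short-high-¬a≲a {l} {m} l≢m short-m high-m =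
      no-exchange (adj-B0 (A l)) (A-adj-B m) (A-nonadj-B l≢m) high-m
        (≲-trans (b≲a′ m) (≲-trans short-m (b₅≲a l)))

    beyond-high-¬a′≲a′ : ∀ {l m} → l ≢ m → Beyond l → High m → ¬ a′ l ≲ a′ m
    beyond-high-¬a′≲a′ {l} {m} l≢m beyond-l high-m =
      no-exchange (adj-B0 (A′ l)) (A′-adj-B m) (A′-nonadj-B l≢m) high-m (≲-trans (b≲a m) (beyond-l m))

    beyond-high-¬late : ∀ {l m} → l ≢ m → Beyond m → High m → ¬ Late l
    beyond-high-¬late {l} {m} l≢m beyond-m high-m late-l =
      no-exchange (adj-B0 (A l)) (A′-adj-B m) (A-nonadj-B l≢m) high-m
        (≲-trans (b≲a₀ m) late-l) (beyond-m l)

    Class₀ Class₁ Class₂ : Leg → Set ℓ₂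
    Class₀ l = Low l × (Short l ⊎ Early l)
    Class₁ l = Short l × High l
    Class₂ l = Beyond l × (High l ⊎ Low l × Late l)

    classify : ∀ l → Class₀ l ⊎ Class₁ l ⊎ Class₂ l
    classify l with short-or-beyond l | total (b l) b₀
    ... | inj₁ short  | inj₁ low  = inj₁ (low , inj₁ short)
    ... | inj₁ short  | inj₂ high = inj₂ (inj₁ (short , high))
    ... | inj₂ beyond | inj₂ high = inj₂ (inj₂ (beyond , inj₁ high))
    ... | inj₂ beyond | inj₁ low with total (a l) a₀
    ...   | inj₁ early = inj₁ (low , inj₂ early)
    ...   | inj₂ late  = inj₂ (inj₂ (beyond , inj₂ (low , late)))

    lower-short-or-early-⊥ : ∀ {l m} → l ≢ m → b l ≲ b m → Low m → ¬ (Short l ⊎ Early l)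
    lower-short-or-early-⊥ {m = m} l≢m bl≲bm low-m (inj₁ short) =
      low-pair-¬a′≲a l≢m bl≲bm low-m (≲-trans short (b₅≲a m))
    lower-short-or-early-⊥ l≢m bl≲bm low-m (inj₂ early) =
      low-pair-¬early l≢m bl≲bm low-m early

    class₀-pairless : Pairless Class₀
    class₀-pairless {l} {m} l≢m (low-l , short-or-early-l) (low-m , short-or-early-m)
      with total (b l) (b m)
    ... | inj₁ bl≲bm = lower-short-or-early-⊥ l≢m bl≲bm low-m short-or-early-l
    ... | inj₂ bm≲bl = lower-short-or-early-⊥ (l≢m ∘ sym) bm≲bl low-l short-or-early-m

    class₁-pairless : Pairless Class₁
    class₁-pairless {l} {m} l≢m (short-l , high-l) (short-m , high-m) with total (a l) (a m)
    ... | inj₁ al≲am = short-high-¬a≲a l≢m short-m high-m al≲am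
    ... | inj₂ am≲al = short-high-¬a≲a (l≢m ∘ sym) short-l high-l am≲al

    class₂-pairless : Pairless Class₂
    class₂-pairless {l} {m} l≢m (beyond-l , inj₁ high-l) (beyond-m , inj₁ high-m)
      with total (a′ l) (a′ m)
    ... | inj₁ a′l≲a′m = beyond-high-¬a′≲a′ l≢m beyond-l high-m a′l≲a′m
    ... | inj₂ a′m≲a′l = beyond-high-¬a′≲a′ (l≢m ∘ sym) beyond-m high-l a′m≲a′l
    class₂-pairless l≢m (beyond-l , inj₁ high-l) (_ , inj₂ (_ , late-m)) =
      beyond-high-¬late (l≢m ∘ sym) beyond-l high-l late-m
    class₂-pairless l≢m (_ , inj₂ (_ , late-l)) (beyond-m , inj₁ high-m) =
      beyond-high-¬late l≢m beyond-m high-m late-l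
    class₂-pairless {l} {m} l≢m (beyond-l , inj₂ (low-l , _)) (beyond-m , inj₂ (low-m , _))
      with total (b l) (b m)
    ... | inj₁ bl≲bm = low-pair-¬beyond l≢m bl≲bm low-m beyond-m
    ... | inj₂ bm≲bl = low-pair-¬beyond (l≢m ∘ sym) bm≲bl low-l beyond-l

    impossible : ⊥
    impossible = pigeonhole₃ (s≤s (s≤s (s≤s (s≤s z≤n)))) classify
                   class₀-pairless class₁-pairless class₂-pairless

  module B5-first (b₅≲b₀ : b₅ ≲ b₀) where

    below-b₅⇒beyond : ∀ {l} → b l ≲ b₅ → Beyond l
    below-b₅⇒beyond {l} bl≲b₅ m =
      ≴⇒≳ (no-exchange (A′-adj-B l) (A-adj-B5 m) (A′-nonadj-B5 l) bl≲b₅ (≲-trans b₅≲b₀ (b₀≲a′ l)))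

    above-b₅-¬a≲ : ∀ {l m x} → l ≢ m → b₅ ≲ b m → b m ≲ a l → Adj x (B m) → ¬ a l ≲ pos₁ x
    above-b₅-¬a≲ {l} l≢m b₅≲bm bm≲al e = no-exchange (A-adj-B5 l) e (A-nonadj-B l≢m) b₅≲bm bm≲al

    Class₀ Class₁ Class₂ : Leg → Set ℓ₂
    Class₀ l = b l ≲ b₅
    Class₁ l = b₅ ≲ b l × Early l
    Class₂ l = b₅ ≲ b l × Late l

    classify : ∀ l → Class₀ l ⊎ Class₁ l ⊎ Class₂ l
    classify l with total (b l) b₅
    ... | inj₁ bl≲b₅ = inj₁ bl≲b₅
    ... | inj₂ b₅≲bl with total (a l) a₀
    ...   | inj₁ early = inj₂ (inj₁ (b₅≲bl , early))
    ...   | inj₂ late  = inj₂ (inj₂ (b₅≲bl , late))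

    class₀-pairless : Pairless Class₀
    class₀-pairless {l} {m} l≢m bl≲b₅ bm≲b₅ with total (b l) (b m)
    ... | inj₁ bl≲bm = low-pair-¬beyond l≢m bl≲bm (≲-trans bm≲b₅ b₅≲b₀) (below-b₅⇒beyond bm≲b₅)
    ... | inj₂ bm≲bl = low-pair-¬beyond (l≢m ∘ sym) bm≲bl (≲-trans bl≲b₅ b₅≲b₀) (below-b₅⇒beyond bl≲b₅)

    class₁-pairless : Pairless Class₁
    class₁-pairless {l} {m} l≢m (b₅≲bl , early-l) (b₅≲bm , early-m) with total (a l) (a m)
    ... | inj₁ al≲am = above-b₅-¬a≲ (l≢m ∘ sym) b₅≲bl (≲-trans (b≲a l) al≲am) (A0-adj (B l)) early-m
    ... | inj₂ am≲al = above-b₅-¬a≲ l≢m b₅≲bm (≲-trans (b≲a m) am≲al) (A0-adj (B m)) early-l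

    class₂-pairless : Pairless Class₂
    class₂-pairless {l} {m} l≢m (b₅≲bl , late-l) (b₅≲bm , late-m) with total (a l) (a m)
    ... | inj₁ al≲am = above-b₅-¬a≲ l≢m b₅≲bm (≲-trans (b≲a₀ m) late-l) (A-adj-B m) al≲am
    ... | inj₂ am≲al = above-b₅-¬a≲ (l≢m ∘ sym) b₅≲bl (≲-trans (b≲a₀ l) late-m) (A-adj-B l) am≲al

    impossible : ⊥
    impossible = pigeonhole₃ (s≤s (s≤s (s≤s (s≤s z≤n)))) classify
                   class₀-pairless class₁-pairless class₂-pairless

  impossible : ⊥
  impossible with total b₀ b₅
  ... | inj₁ b₀≲b₅ = B0-first.impossible b₀≲b₅
  ... | inj₂ b₅≲b₀ = B5-first.impossible b₅≲b₀

py2-no-stick-ordering : ∀ {c ℓ₁ ℓ₂} {O : TotalPreorder c ℓ₁ ℓ₂} → ¬ StickOrdering O Adj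
py2-no-stick-ordering σ = Py2StickOrdering.impossible σ

py2-not-stick : ¬ IsStick Py2V Py2E
py2-not-stick S with StickRep.vert S (inj₁ A0) in A0-orientation
... | true  = py2-no-stick-ordering (Py2Sticks.vertical-A-ordering S A0-orientation)
... | false = py2-no-stick-ordering (Py2Sticks.horizontal-A-ordering S A0-orientation)

proposition5 : Bipartite Py2V Py2E × HoleFree Py2V Py2E × ¬ IsStick Py2V Py2E
proposition5 = py2-bipartite , py2-hole-free , py2-not-stick
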